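{- Let $X = X_1 \uplus X_2$ be a finite set of products partitioned into two levels, with utilities $u(x) > 0$, a no-purchase utility $u_0 > 0$, and revenues $r(x) \ge 0$. Let $S = S_1 \uplus S_2 \subseteq X$ with $S_i \subseteq X_i$, and let $Z$ be a nonempty subset of $S_i$ for some $i \in \{1,2\}$. Then: (a) if $Z \subseteq S_1$, $$R(S) = R(S \setminus Z)\,(1-\lambda(Z,S)) + \left[\alpha(Z) - \frac{\alpha(S_2)U(S_2)(U(S_2)+u_0)(1-\lambda(Z,S))}{(U(S)-U(Z)+u_0)^2}\right]\lambda(Z,S);$$ (b) if $Z \subseteq S_2$, $$R(S) = R(S \setminus Z)\,(1-\lambda(Z,S)) + \left[\frac{\alpha(Z)(U(S_2)+u_0)}{U(S)+u_0} + \frac{\alpha(S_2\setminus Z)(U(S_2)-U(Z))}{U(S)-U(Z)+u_0}\cdot\frac{U(S_1)}{U(S)+u_0}\right]\lambda(Z,S).$$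
   Context: For $S \subseteq X$ write $S_i = S \cap X_i$, $U(S) = \sum_{x \in S} u(x)$, for nonempty $S$, $\alpha(S) = \frac{\sum_{x \in S} u(x) r(x)}{U(S)}$, with the convention $\alpha(\emptyset) = 0$, and for $Z \subseteq S$, $\lambda(Z,S) = \frac{U(Z)}{U(S)+u_0}$. The Sequential Multinomial Logit (SML) model gives, for an offered assortment $S \subseteq X$, choice probabilities $\rho(x,S) = \frac{u(x)}{U(S)+u_0}$ if $x \in S_1$, and $\rho(x,S) = \left(1 - \frac{U(S_1)}{U(S)+u_0}\right)\frac{u(x)}{U(S)+u_0}$ if $x \in S_2$. The expected revenue is $R(S) = \sum_{x \in S} \rho(x,S) r(x)$ (equivalently $R(S) = \frac{\alpha(S_1)U(S_1)}{U(S)+u_0} + \frac{\alpha(S_2)U(S_2)}{U(S)+u_0}\left(1 - \frac{U(S_1)}{U(S)+u_0}\right)$).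
   Formalization: The utilities $u(x)$, the no-purchase utility $u_0$ and the revenues $r(x)$ are rational numbers rather than real ones. -}

module Defs where

open import Data.Bool using (Bool; true; false; if_then_else_)
open import Data.Nat using (ℕ; zero; suc)
open import Data.Fin using (Fin; zero; suc)
open import Data.Fin.Subset using (Subset; _∩_; ∁)
open import Data.Vec using ([]; _∷_)
open import Data.Rational using (ℚ; 0ℚ; 1ℚ; _+_; _-_; _*_; _÷_; ≢-nonZero)
open import Data.Rational.Properties using (_≟_)
open import Relation.Nullary using (yes; no)
open import Function using (_∘_)

-- Total division on ℚ: p /ₜ q = p ÷ q when q ≠ 0, and 0 when q = 0.
-- (Only used with nonzero denominators, except α(∅) = 0 by convention.)
_/ₜ_ : ℚ → ℚ → ℚ
p /ₜ q with q ≟ 0ℚ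
... | yes _ = 0ℚ
... | no q≢0 = _÷_ p q {{≢-nonZero q≢0}}

infixl 7 _/ₜ_

Σₛ : ∀ {n} → Subset n → (Fin n → ℚ) → ℚ
Σₛ [] f = 0ℚ
Σₛ (b ∷ S) f = (if b then f zero else 0ℚ) + Σₛ S (f ∘ suc)

_∖_ : ∀ {n} → Subset n → Subset n → Subset n
S ∖ Z = S ∩ ∁ Z

module SML {n : ℕ} (X₁ : Subset n) (u : Fin n → ℚ) (u₀ : ℚ) (r : Fin n → ℚ) where

  X₂ : Subset n
  X₂ = ∁ X₁

  lvl₁ : Subset n → Subset n
  lvl₁ S = S ∩ X₁

  lvl₂ : Subset n → Subset n
  lvl₂ S = S ∩ X₂

  U : Subset n → ℚ
  U S = Σₛ S u

  -- α(S) = Σ u r / U(S), with α(∅) = 0 (U(∅) = 0 and /ₜ gives 0)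
  α : Subset n → ℚ
  α S = Σₛ S (λ x → u x * r x) /ₜ U S

  λ' : Subset n → Subset n → ℚ
  λ' Z S = U Z /ₜ (U S + u₀)

  ρ : Fin n → Subset n → ℚ
  ρ x S with Data.Vec.lookup X₁ x
  ... | true  = u x /ₜ (U S + u₀)
  ... | false = (1ℚ - U (lvl₁ S) /ₜ (U S + u₀)) * (u x /ₜ (U S + u₀))

  R : Subset n → ℚ
  R S = Σₛ S (λ x → ρ x S * r x)

{-# OPTIONS --safe #-}
-- In the SML model R(S) depends on S only through the level aggregates U(Sᵢ) and
-- Σ_{x ∈ Sᵢ} u(x) r(x) = α(Sᵢ) U(Sᵢ). Removing Z ⊆ Sᵢ subtracts U(Z) and α(Z) U(Z) from the
-- aggregates of level i and leaves the other level unchanged, so both formulas become identities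
-- between rational functions of the aggregates. Treating the reciprocals of the denominators
-- U(S) + u₀ and U(S ∖ Z) + u₀ as fresh variables, each identity becomes a polynomial identity
-- modulo the relations "denominator · reciprocal = 1".
module Submission where

open import Defs
open import Data.Nat as ℕ using (ℕ)
open import Data.Fin using (Fin; zero; suc)
open import Data.Fin.Subset using (Subset; _⊆_; Nonempty; _∈_; _∉_; _∩_; ∁; ⊥)
open import Data.Fin.Subset.Properties
  using (x∈p∩q⁺; p∩q⊆p; p∩q⊆q; ⊆-antisym; ∩-assoc; ∩-comm; x∈p⇒x∉∁p; x∈∁p⇒x∉p; x∉p⇒x∈∁p; nonempty?; Empty-unique)
open import Data.Vec using (_∷_; []; lookup; here; there)
open import Data.Vec.Properties using (lookup⇒[]=; []=⇒lookup)
open import Data.Bool using (Bool; true; false; _∧_; not; if_then_else_)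
open import Data.Product using (_×_; _,_)
open import Function using (_∘_)
open import Level using (0ℓ)
open import Relation.Binary.PropositionalEquality
open import Relation.Nullary using (yes; no; contradiction)
open import Relation.Nullary.Decidable using (dec⇒maybe)
open import Data.Rational using (ℚ; 0ℚ; 1ℚ; _+_; _-_; _*_; _<_; _≤_; ≢-nonZero)
open import Data.Rational.Properties
  using (_≟_; 1≢0; +-*-commutativeRing; +-0-commutativeMonoid; *-identityˡ; *-identityʳ; *-zeroˡ; *-zeroʳ; *-assoc; *-comm;
         *-inverseʳ; *-distribˡ-+; +-identityˡ; +-identityʳ; ≤-refl; <⇒≤; <⇒≢; +-mono-≤; +-mono-<-≤; +-mono-≤-<)
open import Algebra.Bundles using (CommutativeMonoid)
open import Algebra.Properties.CommutativeSemigroup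
  (CommutativeMonoid.commutativeSemigroup +-0-commutativeMonoid) using (interchange)
open import Tactic.RingSolver using (solve-∀)
open import Tactic.RingSolver.Core.AlmostCommutativeRing using (AlmostCommutativeRing; fromCommutativeRing)

ℚ-ring : AlmostCommutativeRing 0ℓ 0ℓ
ℚ-ring = fromCommutativeRing +-*-commutativeRing (λ x → dec⇒maybe (0ℚ ≟ x))

-- Opaque: unfolding it would let conversion checking run into the ℚ normalisation inside _/ₜ_.
opaque
  recip : ℚ → ℚ
  recip q = 1ℚ /ₜ q

opaque
  unfolding recip

  /ₜ≡*recip : ∀ p q → p /ₜ q ≡ p * recip q
  /ₜ≡*recip p q with q ≟ 0ℚ
  ... | yes _ = sym (*-zeroʳ p)
  ... | no _  = cong (p *_) (sym (*-identityˡ _))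

  *-recipʳ : ∀ {q} → q ≢ 0ℚ → q * recip q ≡ 1ℚ
  *-recipʳ {q} q≢0 with q ≟ 0ℚ
  ... | yes q≡0 = contradiction q≡0 q≢0
  ... | no q≢0  = trans (cong (q *_) (*-identityˡ _)) (*-inverseʳ q {{≢-nonZero q≢0}})

recip-unique : ∀ {q x} → q * x ≡ 1ℚ → recip q ≡ x
recip-unique {q} {x} qx≡1 = begin
  recip q              ≡⟨ sym (*-identityʳ _) ⟩
  recip q * 1ℚ         ≡⟨ cong (recip q *_) (sym qx≡1) ⟩
  recip q * (q * x)    ≡⟨ sym (*-assoc (recip q) q x) ⟩
  recip q * q * x      ≡⟨ cong (_* x) (trans (*-comm (recip q) q) (*-recipʳ q≢0)) ⟩
  1ℚ * x               ≡⟨ *-identityˡ x ⟩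
  x                    ∎
  where
  open ≡-Reasoning
  q≢0 : q ≢ 0ℚ
  q≢0 q≡0 = 1≢0 (trans (sym qx≡1) (trans (cong (_* x) q≡0) (*-zeroˡ x)))

recip-* : ∀ {p q} → p ≢ 0ℚ → q ≢ 0ℚ → recip (p * q) ≡ recip p * recip q
recip-* {p} {q} p≢0 q≢0 = recip-unique {p * q} (begin
  p * q * (recip p * recip q)      ≡⟨ regroup p q (recip p) (recip q) ⟩
  p * recip p * (q * recip q)      ≡⟨ cong₂ _*_ (*-recipʳ p≢0) (*-recipʳ q≢0) ⟩
  1ℚ                               ∎)
  where
  open ≡-Reasoning
  regroup : ∀ p q p′ q′ → p * q * (p′ * q′) ≡ p * p′ * (q * q′)
  regroup = solve-∀ ℚ-ring

-- With p = D · recip D and q = E · recip E, an identity in the reciprocals follows from a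
-- polynomial one in which recip D and recip E are free variables, given the cofactors c₁, c₂.
≡-modulo-inverses : ∀ {x y p q c₁ c₂} →
  x ≡ y + (p - 1ℚ) * c₁ + (q - 1ℚ) * c₂ → p ≡ 1ℚ → q ≡ 1ℚ → x ≡ y
≡-modulo-inverses {y = y} {c₁ = c₁} {c₂} x≡ refl refl = trans x≡ (vanish y c₁ c₂)
  where
  vanish : ∀ y c₁ c₂ → y + (1ℚ - 1ℚ) * c₁ + (1ℚ - 1ℚ) * c₂ ≡ y
  vanish = solve-∀ ℚ-ring

p⊆q⇒q∩p≡p : ∀ {n} {p q : Subset n} → p ⊆ q → q ∩ p ≡ p
p⊆q⇒q∩p≡p {p = p} {q} p⊆q = ⊆-antisym (p∩q⊆q q p) (λ x∈p → x∈p∩q⁺ (p⊆q x∈p , x∈p))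

[p∖q]∩r≡[p∩r]∖q : ∀ {n} (p q r : Subset n) → (p ∖ q) ∩ r ≡ (p ∩ r) ∖ q
[p∖q]∩r≡[p∩r]∖q p q r =
  trans (∩-assoc p (∁ q) r) (trans (cong (p ∩_) (∩-comm (∁ q) r)) (sym (∩-assoc p r (∁ q))))

disjoint⇒p∖q≡p : ∀ {n} {p q : Subset n} → (∀ {x} → x ∈ q → x ∉ p) → p ∖ q ≡ p
disjoint⇒p∖q≡p {p = p} {q} q∩p≡∅ =
  ⊆-antisym (p∩q⊆p p (∁ q)) (λ x∈p → x∈p∩q⁺ (x∈p , x∉p⇒x∈∁p (λ x∈q → q∩p≡∅ x∈q x∈p)))

disjoint⇒[p∖q]∩r≡p∩r : ∀ {n} (p q r : Subset n) → (∀ {x} → x ∈ q → x ∉ r) → (p ∖ q) ∩ r ≡ p ∩ r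
disjoint⇒[p∖q]∩r≡p∩r p q r q∩r≡∅ =
  trans ([p∖q]∩r≡[p∩r]∖q p q r) (disjoint⇒p∖q≡p (λ x∈q → q∩r≡∅ x∈q ∘ p∩q⊆q p r))

Σₛ-split : ∀ {n} (p q : Subset n) (f : Fin n → ℚ) → Σₛ p f ≡ Σₛ (p ∩ q) f + Σₛ (p ∖ q) f
Σₛ-split []      []      f = refl
Σₛ-split (x ∷ p) (y ∷ q) f = begin
  head x + Σₛ p (f ∘ suc)
    ≡⟨ cong₂ _+_ (split-head x y) (Σₛ-split p q (f ∘ suc)) ⟩
  (head (x ∧ y) + head (x ∧ not y)) + (Σₛ (p ∩ q) (f ∘ suc) + Σₛ (p ∖ q) (f ∘ suc))
    ≡⟨ interchange (head (x ∧ y)) (head (x ∧ not y)) _ _ ⟩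
  (head (x ∧ y) + Σₛ (p ∩ q) (f ∘ suc)) + (head (x ∧ not y) + Σₛ (p ∖ q) (f ∘ suc))
    ∎
  where
  open ≡-Reasoning
  head : Bool → ℚ
  head b = if b then f zero else 0ℚ
  split-head : ∀ x y → head x ≡ head (x ∧ y) + head (x ∧ not y)
  split-head true  true  = sym (+-identityʳ _)
  split-head true  false = sym (+-identityˡ _)
  split-head false _     = refl

Σₛ-⊆-split : ∀ {n} {p q : Subset n} (f : Fin n → ℚ) → q ⊆ p → Σₛ p f ≡ Σₛ q f + Σₛ (p ∖ q) f
Σₛ-⊆-split {p = p} {q} f q⊆p =
  trans (Σₛ-split p q f) (cong (λ t → Σₛ t f + Σₛ (p ∖ q) f) (p⊆q⇒q∩p≡p q⊆p))

Σₛ-cong : ∀ {n} (p : Subset n) {f g : Fin n → ℚ} → (∀ {x} → x ∈ p → f x ≡ g x) → Σₛ p f ≡ Σₛ p g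
Σₛ-cong []          f≡g = refl
Σₛ-cong (true  ∷ p) f≡g = cong₂ _+_ (f≡g here) (Σₛ-cong p (f≡g ∘ there))
Σₛ-cong (false ∷ p) f≡g = cong (0ℚ +_) (Σₛ-cong p (f≡g ∘ there))

Σₛ-*ˡ : ∀ {n} (p : Subset n) (k : ℚ) (f : Fin n → ℚ) → Σₛ p (λ x → k * f x) ≡ k * Σₛ p f
Σₛ-*ˡ []          k f = sym (*-zeroʳ k)
Σₛ-*ˡ (true  ∷ p) k f = trans (cong (k * f zero +_) (Σₛ-*ˡ p k (f ∘ suc))) (sym (*-distribˡ-+ k _ _))
Σₛ-*ˡ (false ∷ p) k f =
  trans (+-identityˡ _) (trans (Σₛ-*ˡ p k (f ∘ suc)) (cong (k *_) (sym (+-identityˡ _))))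

Σₛ-⊥ : ∀ {n} (f : Fin n → ℚ) → Σₛ ⊥ f ≡ 0ℚ
Σₛ-⊥ {ℕ.zero}  f = refl
Σₛ-⊥ {ℕ.suc n} f = trans (+-identityˡ _) (Σₛ-⊥ (f ∘ suc))

Σₛ-nonneg : ∀ {n} (p : Subset n) {f : Fin n → ℚ} → (∀ x → 0ℚ ≤ f x) → 0ℚ ≤ Σₛ p f
Σₛ-nonneg []          f≥0 = ≤-refl
Σₛ-nonneg (true  ∷ p) f≥0 = +-mono-≤ (f≥0 zero) (Σₛ-nonneg p (f≥0 ∘ suc))
Σₛ-nonneg (false ∷ p) f≥0 = +-mono-≤ ≤-refl (Σₛ-nonneg p (f≥0 ∘ suc))

Σₛ-pos : ∀ {n} (p : Subset n) {f : Fin n → ℚ} → (∀ x → 0ℚ < f x) → Nonempty p → 0ℚ < Σₛ p f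
Σₛ-pos (true  ∷ p) f>0 _                  = +-mono-<-≤ (f>0 zero) (Σₛ-nonneg p (<⇒≤ ∘ f>0 ∘ suc))
Σₛ-pos (false ∷ p) f>0 (suc x , there x∈p) = +-mono-≤-< ≤-refl (Σₛ-pos p (f>0 ∘ suc) (x , x∈p))

-- R(S) in terms of Uᵢ = U(Sᵢ) and Wᵢ = α(Sᵢ) U(Sᵢ).
levelRevenue : (u₀ U₁ W₁ U₂ W₂ : ℚ) → ℚ
levelRevenue u₀ U₁ W₁ U₂ W₂ = let d = recip (U₁ + U₂ + u₀) in d * W₁ + (1ℚ - U₁ * d) * d * W₂

levelRevenue-remove₁ : ∀ {u₀ U₁ W₁ z αz a wa b wb α₂ D E} →
  U₁ ≡ z + a → W₁ ≡ αz * z + wa → wb ≡ α₂ * b → D ≡ U₁ + b + u₀ → E ≡ a + b + u₀ →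
  U₁ + b + u₀ ≢ 0ℚ → a + b + u₀ ≢ 0ℚ →
  levelRevenue u₀ U₁ W₁ b wb
    ≡ levelRevenue u₀ a wa b wb * (1ℚ - z /ₜ D)
      + (αz - (α₂ * b * (b + u₀) * (1ℚ - z /ₜ D)) /ₜ (E * E)) * (z /ₜ D)
levelRevenue-remove₁ {u₀} {z = z} {αz} {a} {wa} {b} {α₂ = α₂} {D} {E} refl refl refl refl refl D≢0 E≢0
  rewrite /ₜ≡*recip z D
        | /ₜ≡*recip (α₂ * b * (b + u₀) * (1ℚ - z * recip D)) (E * E)
  = trans (≡-modulo-inverses (certificate z a b u₀ αz wa (α₂ * b) (recip D) (recip E))
                             (*-recipʳ D≢0) (*-recipʳ E≢0))
          (cong (λ s → levelRevenue u₀ a wa b (α₂ * b) * (1ℚ - z * recip D)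
                       + (αz - α₂ * b * (b + u₀) * (1ℚ - z * recip D) * s) * (z * recip D))
                (sym (recip-* E≢0 E≢0)))
  where
  certificate : ∀ z a b u₀ αz wa wb d e →
    d * (αz * z + wa) + (1ℚ - (z + a) * d) * d * wb
    ≡ (e * wa + (1ℚ - a * e) * e * wb) * (1ℚ - z * d)
      + (αz - wb * (b + u₀) * (1ℚ - z * d) * (e * e)) * (z * d)
      + ((z + a + b + u₀) * d - 1ℚ)
        * (e * wa + (1ℚ - a * e) * e * wb - d * wb * a * e - wb * (b + u₀) * e * e * z * d)
      + ((a + b + u₀) * e - 1ℚ)
        * (d * wb * (z + a) * d - d * wa - d * wb * (1ℚ - a * e) + wb * (b + u₀) * z * d * d * e)
  certificate = solve-∀ ℚ-ring

levelRevenue-remove₂ : ∀ {u₀ U₁ W₁ U₂ W₂ z αz c wc α₃ D E} →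
  U₂ ≡ z + c → W₂ ≡ αz * z + wc → wc ≡ α₃ * c → D ≡ U₁ + U₂ + u₀ → E ≡ U₁ + c + u₀ →
  U₁ + U₂ + u₀ ≢ 0ℚ → U₁ + c + u₀ ≢ 0ℚ →
  levelRevenue u₀ U₁ W₁ U₂ W₂
    ≡ levelRevenue u₀ U₁ W₁ c wc * (1ℚ - z /ₜ D)
      + ((αz * (U₂ + u₀)) /ₜ D + ((α₃ * (U₂ - z)) /ₜ E) * (U₁ /ₜ D)) * (z /ₜ D)
levelRevenue-remove₂ {u₀} {a₁} {w₁} {z = z} {αz} {c} {α₃ = α₃} {D} {E} refl refl refl refl refl D≢0 E≢0
  rewrite /ₜ≡*recip z D
        | /ₜ≡*recip a₁ D
        | /ₜ≡*recip (αz * (z + c + u₀)) D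
        | /ₜ≡*recip (α₃ * (z + c - z)) E
  = trans (≡-modulo-inverses (certificate a₁ w₁ z c u₀ αz (α₃ * c) (recip D) (recip E))
                             (*-recipʳ D≢0) (*-recipʳ E≢0))
          (cong (λ t → levelRevenue u₀ a₁ w₁ c (α₃ * c) * (1ℚ - z * recip D)
                       + (αz * (z + c + u₀) * recip D + α₃ * t * recip E * (a₁ * recip D)) * (z * recip D))
                (sym (z+c-z≡c z c)))
  where
  z+c-z≡c : ∀ z c → z + c - z ≡ c
  z+c-z≡c = solve-∀ ℚ-ring
  certificate : ∀ a₁ w₁ z c u₀ αz wc d e →
    d * w₁ + (1ℚ - a₁ * d) * d * (αz * z + wc)
    ≡ (e * w₁ + (1ℚ - a₁ * e) * e * wc) * (1ℚ - z * d)
      + (αz * (z + c + u₀) * d + wc * e * (a₁ * d)) * (z * d)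
      + ((a₁ + (z + c) + u₀) * d - 1ℚ) * (e * w₁ + (1ℚ - a₁ * e) * e * wc - d * αz * z - d * wc * a₁ * e)
      + ((a₁ + c + u₀) * e - 1ℚ) * (d * wc * a₁ * d - d * w₁ - d * wc * (1ℚ - a₁ * e))
  certificate = solve-∀ ℚ-ring

module _ {n : ℕ} (X₁ : Subset n) (u : Fin n → ℚ) (u₀ : ℚ) (r : Fin n → ℚ)
         (u>0 : ∀ x → 0ℚ < u x) (u₀>0 : 0ℚ < u₀) where

  open SML X₁ u u₀ r

  w : Fin n → ℚ
  w x = u x * r x

  W : Subset n → ℚ
  W S = Σₛ S w

  U-levels : ∀ S → U S ≡ U (lvl₁ S) + U (lvl₂ S)
  U-levels S = Σₛ-split S X₁ u

  ρ-level₁ : ∀ {x} S → x ∈ X₁ → ρ x S ≡ u x * recip (U S + u₀)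
  ρ-level₁ {x} S x∈X₁ with lookup X₁ x | []=⇒lookup x∈X₁
  ... | true | _ = /ₜ≡*recip (u x) (U S + u₀)

  ρ-level₂ : ∀ {x} S → x ∈ X₂ →
    ρ x S ≡ (1ℚ - U (lvl₁ S) * recip (U S + u₀)) * (u x * recip (U S + u₀))
  ρ-level₂ {x} S x∈X₂ with lookup X₁ x in eq
  ... | true  = contradiction (lookup⇒[]= x X₁ eq) (x∈∁p⇒x∉p x∈X₂)
  ... | false = cong₂ _*_ (cong (1ℚ -_) (/ₜ≡*recip (U (lvl₁ S)) (U S + u₀))) (/ₜ≡*recip (u x) (U S + u₀))

  R-levels : ∀ S → R S ≡ levelRevenue u₀ (U (lvl₁ S)) (W (lvl₁ S)) (U (lvl₂ S)) (W (lvl₂ S))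
  R-levels S = begin
    Σₛ S g
      ≡⟨ Σₛ-split S X₁ g ⟩
    Σₛ S₁ g + Σₛ S₂ g
      ≡⟨ cong₂ _+_ (Σₛ-cong S₁ level₁) (Σₛ-cong S₂ level₂) ⟩
    Σₛ S₁ (λ x → d * w x) + Σₛ S₂ (λ x → k * w x)
      ≡⟨ cong₂ _+_ (Σₛ-*ˡ S₁ d w) (Σₛ-*ˡ S₂ k w) ⟩
    d * W S₁ + k * W S₂
      ≡⟨ cong (λ D → recip D * W S₁ + (1ℚ - U S₁ * recip D) * recip D * W S₂) (cong (_+ u₀) (U-levels S)) ⟩
    levelRevenue u₀ (U S₁) (W S₁) (U S₂) (W S₂)
      ∎
    where
    open ≡-Reasoning
    S₁ S₂ : Subset n
    S₁ = lvl₁ S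
    S₂ = lvl₂ S
    g : Fin n → ℚ
    g x = ρ x S * r x
    d k : ℚ
    d = recip (U S + u₀)
    k = (1ℚ - U S₁ * d) * d
    regroup₁ : ∀ p d s → p * d * s ≡ d * (p * s)
    regroup₁ = solve-∀ ℚ-ring
    regroup₂ : ∀ c p d s → c * (p * d) * s ≡ c * d * (p * s)
    regroup₂ = solve-∀ ℚ-ring
    level₁ : ∀ {x} → x ∈ S₁ → g x ≡ d * w x
    level₁ {x} x∈S₁ = trans (cong (_* r x) (ρ-level₁ S (p∩q⊆q S X₁ x∈S₁))) (regroup₁ (u x) d (r x))
    level₂ : ∀ {x} → x ∈ S₂ → g x ≡ k * w x
    level₂ {x} x∈S₂ = trans (cong (_* r x) (ρ-level₂ S (p∩q⊆q S X₂ x∈S₂))) (regroup₂ (1ℚ - U S₁ * d) (u x) d (r x))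

  α*U≡W : ∀ S → α S * U S ≡ W S
  α*U≡W S with nonempty? S
  ... | yes S≢∅ = begin
    α S * U S                  ≡⟨ cong (_* U S) (/ₜ≡*recip (W S) (U S)) ⟩
    W S * recip (U S) * U S    ≡⟨ *-assoc (W S) _ _ ⟩
    W S * (recip (U S) * U S)  ≡⟨ cong (W S *_) (trans (*-comm _ (U S)) (*-recipʳ U≢0)) ⟩
    W S * 1ℚ                   ≡⟨ *-identityʳ (W S) ⟩
    W S                        ∎
    where
    open ≡-Reasoning
    U≢0 : U S ≢ 0ℚ
    U≢0 = ≢-sym (<⇒≢ (Σₛ-pos S u>0 S≢∅))
  ... | no S≡∅ rewrite Empty-unique S≡∅ =
    trans (cong (α ⊥ *_) (Σₛ-⊥ u)) (trans (*-zeroʳ (α ⊥)) (sym (Σₛ-⊥ w)))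

  U+U+u₀≢0 : ∀ S S′ → U S + U S′ + u₀ ≢ 0ℚ
  U+U+u₀≢0 S S′ = ≢-sym (<⇒≢ (+-mono-≤-< (+-mono-≤ (U≥0 S) (U≥0 S′)) u₀>0))
    where
    U≥0 : ∀ S → 0ℚ ≤ U S
    U≥0 S = Σₛ-nonneg S (<⇒≤ ∘ u>0)

  R-remove₁ : ∀ S Z → Z ⊆ lvl₁ S →
    R S ≡ R (S ∖ Z) * (1ℚ - λ' Z S)
          + (α Z - (α (lvl₂ S) * U (lvl₂ S) * (U (lvl₂ S) + u₀) * (1ℚ - λ' Z S))
                   /ₜ ((U S - U Z + u₀) * (U S - U Z + u₀))) * λ' Z S
  R-remove₁ S Z Z⊆S₁ =
    trans (R-levels S)
      (trans (levelRevenue-remove₁ {αz = α Z} {α₂ = α S₂} U-S₁ W-S₁ (sym (α*U≡W S₂))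
                                   (cong (_+ u₀) (U-levels S)) E≡ (U+U+u₀≢0 S₁ S₂) (U+U+u₀≢0 A S₂))
             (cong₂ _+_ (cong (_* (1ℚ - λ' Z S)) (sym R-S∖Z)) refl))
    where
    S₁ S₂ A : Subset n
    S₁ = lvl₁ S
    S₂ = lvl₂ S
    A  = S₁ ∖ Z
    U-S₁ : U S₁ ≡ U Z + U A
    U-S₁ = Σₛ-⊆-split u Z⊆S₁
    W-S₁ : W S₁ ≡ α Z * U Z + W A
    W-S₁ = trans (Σₛ-⊆-split w Z⊆S₁) (cong (_+ W A) (sym (α*U≡W Z)))
    z+a+b-z+u≡a+b+u : ∀ z a b u → z + a + b - z + u ≡ a + b + u
    z+a+b-z+u≡a+b+u = solve-∀ ℚ-ring
    E≡ : U S - U Z + u₀ ≡ U A + U S₂ + u₀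
    E≡ = trans (cong (λ t → t - U Z + u₀) (trans (U-levels S) (cong (_+ U S₂) U-S₁)))
               (z+a+b-z+u≡a+b+u (U Z) (U A) (U S₂) u₀)
    R-S∖Z : R (S ∖ Z) ≡ levelRevenue u₀ (U A) (W A) (U S₂) (W S₂)
    R-S∖Z = trans (R-levels (S ∖ Z))
      (cong₂ (λ T₁ T₂ → levelRevenue u₀ (U T₁) (W T₁) (U T₂) (W T₂))
             ([p∖q]∩r≡[p∩r]∖q S Z X₁)
             (disjoint⇒[p∖q]∩r≡p∩r S Z X₂ (x∈p⇒x∉∁p ∘ p∩q⊆q S X₁ ∘ Z⊆S₁)))

  R-remove₂ : ∀ S Z → Z ⊆ lvl₂ S →
    R S ≡ R (S ∖ Z) * (1ℚ - λ' Z S)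
          + ((α Z * (U (lvl₂ S) + u₀)) /ₜ (U S + u₀)
             + ((α (lvl₂ S ∖ Z) * (U (lvl₂ S) - U Z)) /ₜ (U S - U Z + u₀))
               * (U (lvl₁ S) /ₜ (U S + u₀))) * λ' Z S
  R-remove₂ S Z Z⊆S₂ =
    trans (R-levels S)
      (trans (levelRevenue-remove₂ {αz = α Z} {α₃ = α C} U-S₂ W-S₂ (sym (α*U≡W C))
                                   (cong (_+ u₀) (U-levels S)) E≡ (U+U+u₀≢0 S₁ S₂) (U+U+u₀≢0 S₁ C))
             (cong₂ _+_ (cong (_* (1ℚ - λ' Z S)) (sym R-S∖Z)) refl))
    where
    S₁ S₂ C : Subset n
    S₁ = lvl₁ S
    S₂ = lvl₂ S
    C  = S₂ ∖ Z
    U-S₂ : U S₂ ≡ U Z + U C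
    U-S₂ = Σₛ-⊆-split u Z⊆S₂
    W-S₂ : W S₂ ≡ α Z * U Z + W C
    W-S₂ = trans (Σₛ-⊆-split w Z⊆S₂) (cong (_+ W C) (sym (α*U≡W Z)))
    a+[z+c]-z+u≡a+c+u : ∀ a z c u → a + (z + c) - z + u ≡ a + c + u
    a+[z+c]-z+u≡a+c+u = solve-∀ ℚ-ring
    E≡ : U S - U Z + u₀ ≡ U S₁ + U C + u₀
    E≡ = trans (cong (λ t → t - U Z + u₀) (trans (U-levels S) (cong (U S₁ +_) U-S₂)))
               (a+[z+c]-z+u≡a+c+u (U S₁) (U Z) (U C) u₀)
    R-S∖Z : R (S ∖ Z) ≡ levelRevenue u₀ (U S₁) (W S₁) (U C) (W C)
    R-S∖Z = trans (R-levels (S ∖ Z))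
      (cong₂ (λ T₁ T₂ → levelRevenue u₀ (U T₁) (W T₁) (U T₂) (W T₂))
             (disjoint⇒[p∖q]∩r≡p∩r S Z X₁ (x∈∁p⇒x∉p ∘ p∩q⊆q S X₂ ∘ Z⊆S₂))
             ([p∖q]∩r≡[p∩r]∖q S Z X₂))

lemma1 : ∀ {n : ℕ} (X₁ : Subset n) (u : Fin n → ℚ) (u₀ : ℚ) (r : Fin n → ℚ)
    → (∀ x → 0ℚ < u x) → 0ℚ < u₀ → (∀ x → 0ℚ ≤ r x)
    → (S Z : Subset n) → Nonempty Z
    → let open SML X₁ u u₀ r in
      (Z ⊆ lvl₁ S →
        R S ≡ R (S ∖ Z) * (1ℚ - λ' Z S)
              + (α Z - (α (lvl₂ S) * U (lvl₂ S) * (U (lvl₂ S) + u₀) * (1ℚ - λ' Z S))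
                       /ₜ ((U S - U Z + u₀) * (U S - U Z + u₀))) * λ' Z S)
      × (Z ⊆ lvl₂ S →
        R S ≡ R (S ∖ Z) * (1ℚ - λ' Z S)
              + ((α Z * (U (lvl₂ S) + u₀)) /ₜ (U S + u₀)
                 + ((α (lvl₂ S ∖ Z) * (U (lvl₂ S) - U Z)) /ₜ (U S - U Z + u₀))
                   * (U (lvl₁ S) /ₜ (U S + u₀))) * λ' Z S)
lemma1 X₁ u u₀ r u>0 u₀>0 _ S Z _ = R-remove₁ X₁ u u₀ r u>0 u₀>0 S Z , R-remove₂ X₁ u u₀ r u>0 u₀>0 S Z
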